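{- Let $(\Gamma,<_1,<_2,<_3)$ be a homogeneous 3-dimensional permutation structure and let $(p,q,r,s)$ be a permutation of the 2-types $(0,1,2,3)$. Suppose $p\Rightarrow q$, $C_3(p,q,r)$ and $C_3(p,q,s)$ are forbidden. If the 2-types $p$ and $q$ are realized in $\Gamma$, then $q\Leftarrow p$ is realized.
   Context: Homogeneous: countable, every isomorphism between finite substructures extends to an automorphism. For a 2-type $t$ write $x\xrightarrow{t}y$ if the pair $(x,y)$ has type $t$. The 2-types $0,1,2,3$ are: $0$: $y<_i x$ for $i=1,2,3$; $1$: $y<_1x$, $x<_2y$, $x<_3y$; $2$: $x<_1y$, $y<_2x$, $x<_3y$; $3$: $x<_1y$, $x<_2y$, $y<_3x$. For 2-types $p,q,r$, the configurations on three distinct points $x,y,z$ are: $p\Rightarrow q$: $z\xrightarrow{p}x$, $z\xrightarrow{p}y$, $x\xrightarrow{q}y$; $p\Leftarrow q$: $x\xrightarrow{p}z$, $y\xrightarrow{p}z$, $x\xrightarrow{q}y$; $C_3(p,q,r)$: $z\xrightarrow{p}x$, $x\xrightarrow{q}y$, $y\xrightarrow{r}z$. Such a configuration (or 2-type) is forbidden if not realized by any tuple of $\Gamma$, and realized otherwise. -}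

module Defs where

open import Data.Nat using (ℕ)
open import Data.Fin using (Fin)
open import Data.Product using (Σ; _×_; ∃-syntax)
open import Relation.Binary.PropositionalEquality using (_≡_; _≢_)
open import Relation.Binary.Structures using (IsStrictPartialOrder)
open import Data.Sum using (_⊎_)
open import Function.Bundles using (_↣_; _↔_; Inverse; _⇔_)

record PermStr3 : Set₁ where
  field
    Carrier : Set
    _<₁_ _<₂_ _<₃_ : Carrier → Carrier → Set
    isSPO₁ : IsStrictPartialOrder _≡_ _<₁_
    isSPO₂ : IsStrictPartialOrder _≡_ _<₂_
    isSPO₃ : IsStrictPartialOrder _≡_ _<₃_
    linear₁ : ∀ x y → x ≢ y → (x <₁ y) ⊎ (y <₁ x)
    linear₂ : ∀ x y → x ≢ y → (x <₂ y) ⊎ (y <₂ x)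
    linear₃ : ∀ x y → x ≢ y → (x <₃ y) ⊎ (y <₃ x)

module _ (Γ : PermStr3) where
  open PermStr3 Γ

  Countable : Set
  Countable = Carrier ↣ ℕ

  IsAutomorphism : (Carrier ↔ Carrier) → Set
  IsAutomorphism σ =
    ∀ x y → ((x <₁ y) ⇔ (f x <₁ f y)) × ((x <₂ y) ⇔ (f x <₂ f y)) × ((x <₃ y) ⇔ (f x <₃ f y))
    where f = Inverse.to σ

  IsFinitePartialIso : {n : ℕ} → (Fin n → Carrier) → (Fin n → Carrier) → Set
  IsFinitePartialIso {n} a b =
    (∀ i j → a i ≡ a j → i ≡ j) × (∀ i j → b i ≡ b j → i ≡ j) ×
    (∀ i j → ((a i <₁ a j) ⇔ (b i <₁ b j)) × ((a i <₂ a j) ⇔ (b i <₂ b j)) × ((a i <₃ a j) ⇔ (b i <₃ b j)))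

  Homogeneous : Set
  Homogeneous =
    Countable ×
    (∀ (n : ℕ) (a b : Fin n → Carrier) → IsFinitePartialIso a b →
      Σ (Carrier ↔ Carrier) λ σ → IsAutomorphism σ × (∀ i → Inverse.to σ (a i) ≡ b i))

data Type2 : Set where
  t0 t1 t2 t3 : Type2

module _ (Γ : PermStr3) where
  open PermStr3 Γ

  HasType : Type2 → Carrier → Carrier → Set
  HasType t0 x y = (y <₁ x) × (y <₂ x) × (y <₃ x)
  HasType t1 x y = (y <₁ x) × (x <₂ y) × (x <₃ y)
  HasType t2 x y = (x <₁ y) × (y <₂ x) × (x <₃ y)
  HasType t3 x y = (x <₁ y) × (x <₂ y) × (y <₃ x)

  Distinct3 : Carrier → Carrier → Carrier → Set
  Distinct3 x y z = x ≢ y × y ≢ z × x ≢ z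

  RealizedType : Type2 → Set
  RealizedType t = ∃[ x ] ∃[ y ] HasType t x y

  Realized⇒ : Type2 → Type2 → Set
  Realized⇒ p q = ∃[ x ] ∃[ y ] ∃[ z ]
    Distinct3 x y z × HasType p z x × HasType p z y × HasType q x y

  Realized⇐ : Type2 → Type2 → Set
  Realized⇐ p q = ∃[ x ] ∃[ y ] ∃[ z ]
    Distinct3 x y z × HasType p x z × HasType p y z × HasType q x y

  RealizedC₃ : Type2 → Type2 → Type2 → Set
  RealizedC₃ p q r = ∃[ x ] ∃[ y ] ∃[ z ]
    Distinct3 x y z × HasType p z x × HasType q x y × HasType r y z

-- The pair (x , y) of distinct points has one of the four 2-types either as
-- (x , y) or as (y , x), and any two 2-types agree on some coordinate order.
-- So after a p-step a → b and a q-step b → e, the coordinate on which p and q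
-- agree fixes how a compares with e, leaving three possibilities: a →p e (a
-- configuration p ⇒ q), a →q e (the sought q ⇐ p), or e →t a with t ∉ {p , q},
-- i.e. t ∈ {r , s} (a configuration C₃(p,q,t)). Homogeneity supplies the q-step
-- b → e: an automorphism carries the tail of a realization of q onto b.
module Submission where

open import Defs
open import Data.Empty using (⊥; ⊥-elim)
open import Data.Fin using (Fin; zero; suc)
open import Data.Fin.Properties using (injective⇒≤)
open import Data.Nat using (_≤_)
open import Data.Nat.Properties using (1+n≰n)
open import Data.Product using (_×_; _,_; proj₁; proj₂; ∃-syntax)
open import Data.Sum using (_⊎_; inj₁; inj₂)
open import Data.Vec using (Vec; []; _∷_; lookup)
open import Data.Vec.Relation.Unary.All using ([]; _∷_)
open import Data.Vec.Relation.Unary.AllPairs using ([]; _∷_)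
open import Data.Vec.Relation.Unary.Unique.Propositional using (Unique)
open import Data.Vec.Relation.Unary.Unique.Propositional.Properties using (lookup-injective)
open import Function.Bundles using (_↔_; _⇔_; Inverse; Equivalence; mk⇔)
open import Relation.Binary.Definitions using (DecidableEquality)
open import Relation.Binary.PropositionalEquality using (_≡_; _≢_; ≢-sym; refl; sym; trans; cong; subst)
open import Relation.Binary.Structures using (IsStrictPartialOrder)
open import Relation.Nullary using (¬_; yes; no; contradiction)
open import Relation.Nullary.Decidable using (map′)
import Data.Fin as Fin

toFin : Type2 → Fin 4
toFin t0 = zero
toFin t1 = suc zero
toFin t2 = suc (suc zero)
toFin t3 = suc (suc (suc zero))

fromFin : Fin 4 → Type2
fromFin zero = t0
fromFin (suc zero) = t1
fromFin (suc (suc zero)) = t2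
fromFin (suc (suc (suc zero))) = t3

fromFin-toFin : ∀ t → fromFin (toFin t) ≡ t
fromFin-toFin t0 = refl
fromFin-toFin t1 = refl
fromFin-toFin t2 = refl
fromFin-toFin t3 = refl

toFin-injective : ∀ {t u} → toFin t ≡ toFin u → t ≡ u
toFin-injective {t} {u} eq = trans (sym (fromFin-toFin t)) (trans (cong fromFin eq) (fromFin-toFin u))

_≟_ : DecidableEquality Type2
t ≟ u = map′ toFin-injective (cong toFin) (toFin t Fin.≟ toFin u)

unique-types-≤4 : ∀ {n} {ts : Vec Type2 n} → Unique ts → n ≤ 4
unique-types-≤4 u = injective⇒≤ (λ eq → lookup-injective u _ _ (toFin-injective eq))

other-pair : ∀ {p q r s t} → p ≢ q → p ≢ r → p ≢ s → q ≢ r → q ≢ s → r ≢ s →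
  t ≢ p → t ≢ q → t ≡ r ⊎ t ≡ s
other-pair {r = r} {s} {t} p≢q p≢r p≢s q≢r q≢s r≢s t≢p t≢q with t ≟ r | t ≟ s
... | yes t≡r | _ = inj₁ t≡r
... | no _ | yes t≡s = inj₂ t≡s
... | no t≢r | no t≢s = contradiction (unique-types-≤4 five-distinct) 1+n≰n
  where
  five-distinct : Unique (t ∷ _ ∷ _ ∷ _ ∷ _ ∷ [])
  five-distinct = (t≢p ∷ t≢q ∷ t≢r ∷ t≢s ∷ []) ∷ (p≢q ∷ p≢r ∷ p≢s ∷ []) ∷ (q≢r ∷ q≢s ∷ []) ∷ (r≢s ∷ []) ∷ [] ∷ []

module PermStr3Properties (Γ : PermStr3) where
  open PermStr3 Γ
  open IsStrictPartialOrder isSPO₁ renaming (irrefl to irrefl₁; trans to trans₁)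
  open IsStrictPartialOrder isSPO₂ renaming (irrefl to irrefl₂; trans to trans₂)
  open IsStrictPartialOrder isSPO₃ renaming (irrefl to irrefl₃; trans to trans₃)

  infix 4 _—[_]→_
  _—[_]→_ : Carrier → Type2 → Carrier → Set
  x —[ t ]→ y = HasType Γ t x y

  asym₁ : ∀ {x y} → x <₁ y → y <₁ x → ⊥
  asym₁ h k = irrefl₁ refl (trans₁ h k)
  asym₂ : ∀ {x y} → x <₂ y → y <₂ x → ⊥
  asym₂ h k = irrefl₂ refl (trans₂ h k)
  asym₃ : ∀ {x y} → x <₃ y → y <₃ x → ⊥
  asym₃ h k = irrefl₃ refl (trans₃ h k)

  cycle₁ : ∀ {x y z} → x <₁ y → y <₁ z → z <₁ x → ⊥
  cycle₁ h k l = asym₁ h (trans₁ k l)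
  cycle₂ : ∀ {x y z} → x <₂ y → y <₂ z → z <₂ x → ⊥
  cycle₂ h k l = asym₂ h (trans₂ k l)
  cycle₃ : ∀ {x y z} → x <₃ y → y <₃ z → z <₃ x → ⊥
  cycle₃ h k l = asym₃ h (trans₃ k l)

  type-irrefl : ∀ {t x y} → x —[ t ]→ y → x ≢ y
  type-irrefl {t0} (h , _) refl = irrefl₁ refl h
  type-irrefl {t1} (h , _) refl = irrefl₁ refl h
  type-irrefl {t2} (h , _) refl = irrefl₁ refl h
  type-irrefl {t3} (h , _) refl = irrefl₁ refl h

  pair-type : ∀ {x y} → x ≢ y → ∃[ t ] (x —[ t ]→ y ⊎ y —[ t ]→ x)
  pair-type {x} {y} x≢y with linear₁ x y x≢y | linear₂ x y x≢y | linear₃ x y x≢y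
  ... | inj₁ l₁ | inj₁ l₂ | inj₁ l₃ = t0 , inj₂ (l₁ , l₂ , l₃)
  ... | inj₁ l₁ | inj₁ l₂ | inj₂ l₃ = t3 , inj₁ (l₁ , l₂ , l₃)
  ... | inj₁ l₁ | inj₂ l₂ | inj₁ l₃ = t2 , inj₁ (l₁ , l₂ , l₃)
  ... | inj₁ l₁ | inj₂ l₂ | inj₂ l₃ = t1 , inj₂ (l₁ , l₂ , l₃)
  ... | inj₂ l₁ | inj₁ l₂ | inj₁ l₃ = t1 , inj₁ (l₁ , l₂ , l₃)
  ... | inj₂ l₁ | inj₁ l₂ | inj₂ l₃ = t2 , inj₂ (l₁ , l₂ , l₃)
  ... | inj₂ l₁ | inj₂ l₂ | inj₁ l₃ = t3 , inj₂ (l₁ , l₂ , l₃)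
  ... | inj₂ l₁ | inj₂ l₂ | inj₂ l₃ = t0 , inj₁ (l₁ , l₂ , l₃)

  -- Each contradiction below is a cycle in the coordinate order on which the given
  -- 2-types agree (for composite-not-third: on which p and q agree; t disagrees there).
  type-asym : ∀ {u v x y} → x —[ u ]→ y → y —[ v ]→ x → ⊥
  type-asym {t0} {t0} (h , _ , _) (k , _ , _) = asym₁ h k
  type-asym {t0} {t1} (h , _ , _) (k , _ , _) = asym₁ h k
  type-asym {t0} {t2} (_ , h , _) (_ , k , _) = asym₂ h k
  type-asym {t0} {t3} (_ , _ , h) (_ , _ , k) = asym₃ h k
  type-asym {t1} {t0} (h , _ , _) (k , _ , _) = asym₁ h k
  type-asym {t1} {t1} (h , _ , _) (k , _ , _) = asym₁ h k
  type-asym {t1} {t2} (_ , _ , h) (_ , _ , k) = asym₃ h k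
  type-asym {t1} {t3} (_ , h , _) (_ , k , _) = asym₂ h k
  type-asym {t2} {t0} (_ , h , _) (_ , k , _) = asym₂ h k
  type-asym {t2} {t1} (_ , _ , h) (_ , _ , k) = asym₃ h k
  type-asym {t2} {t2} (h , _ , _) (k , _ , _) = asym₁ h k
  type-asym {t2} {t3} (h , _ , _) (k , _ , _) = asym₁ h k
  type-asym {t3} {t0} (_ , _ , h) (_ , _ , k) = asym₃ h k
  type-asym {t3} {t1} (_ , h , _) (_ , k , _) = asym₂ h k
  type-asym {t3} {t2} (h , _ , _) (k , _ , _) = asym₁ h k
  type-asym {t3} {t3} (h , _ , _) (k , _ , _) = asym₁ h k

  no-C₃-uuv : ∀ {u v x y z} → z —[ u ]→ x → x —[ u ]→ y → y —[ v ]→ z → ⊥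
  no-C₃-uuv {t0} {t0} (zx , _ , _) (xy , _ , _) (yz , _ , _) = cycle₁ xy zx yz
  no-C₃-uuv {t0} {t1} (zx , _ , _) (xy , _ , _) (yz , _ , _) = cycle₁ xy zx yz
  no-C₃-uuv {t0} {t2} (_ , zx , _) (_ , xy , _) (_ , yz , _) = cycle₂ xy zx yz
  no-C₃-uuv {t0} {t3} (_ , _ , zx) (_ , _ , xy) (_ , _ , yz) = cycle₃ xy zx yz
  no-C₃-uuv {t1} {t0} (zx , _ , _) (xy , _ , _) (yz , _ , _) = cycle₁ xy zx yz
  no-C₃-uuv {t1} {t1} (zx , _ , _) (xy , _ , _) (yz , _ , _) = cycle₁ xy zx yz
  no-C₃-uuv {t1} {t2} (_ , _ , zx) (_ , _ , xy) (_ , _ , yz) = cycle₃ zx xy yz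
  no-C₃-uuv {t1} {t3} (_ , zx , _) (_ , xy , _) (_ , yz , _) = cycle₂ zx xy yz
  no-C₃-uuv {t2} {t0} (_ , zx , _) (_ , xy , _) (_ , yz , _) = cycle₂ xy zx yz
  no-C₃-uuv {t2} {t1} (_ , _ , zx) (_ , _ , xy) (_ , _ , yz) = cycle₃ zx xy yz
  no-C₃-uuv {t2} {t2} (zx , _ , _) (xy , _ , _) (yz , _ , _) = cycle₁ zx xy yz
  no-C₃-uuv {t2} {t3} (zx , _ , _) (xy , _ , _) (yz , _ , _) = cycle₁ zx xy yz
  no-C₃-uuv {t3} {t0} (_ , _ , zx) (_ , _ , xy) (_ , _ , yz) = cycle₃ xy zx yz
  no-C₃-uuv {t3} {t1} (_ , zx , _) (_ , xy , _) (_ , yz , _) = cycle₂ zx xy yz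
  no-C₃-uuv {t3} {t2} (zx , _ , _) (xy , _ , _) (yz , _ , _) = cycle₁ zx xy yz
  no-C₃-uuv {t3} {t3} (zx , _ , _) (xy , _ , _) (yz , _ , _) = cycle₁ zx xy yz

  composite-not-third : ∀ {p q t a b e} → p ≢ q → t ≢ p → t ≢ q →
    a —[ p ]→ b → b —[ q ]→ e → a —[ t ]→ e → ⊥
  composite-not-third {t0} {t1} {t2} _ _ _ (ab , _ , _) (be , _ , _) (ae , _ , _) = cycle₁ ae be ab
  composite-not-third {t0} {t1} {t3} _ _ _ (ab , _ , _) (be , _ , _) (ae , _ , _) = cycle₁ ae be ab
  composite-not-third {t0} {t2} {t1} _ _ _ (_ , ab , _) (_ , be , _) (_ , ae , _) = cycle₂ ae be ab
  composite-not-third {t0} {t2} {t3} _ _ _ (_ , ab , _) (_ , be , _) (_ , ae , _) = cycle₂ ae be ab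
  composite-not-third {t0} {t3} {t1} _ _ _ (_ , _ , ab) (_ , _ , be) (_ , _ , ae) = cycle₃ ae be ab
  composite-not-third {t0} {t3} {t2} _ _ _ (_ , _ , ab) (_ , _ , be) (_ , _ , ae) = cycle₃ ae be ab
  composite-not-third {t1} {t0} {t2} _ _ _ (ab , _ , _) (be , _ , _) (ae , _ , _) = cycle₁ ae be ab
  composite-not-third {t1} {t0} {t3} _ _ _ (ab , _ , _) (be , _ , _) (ae , _ , _) = cycle₁ ae be ab
  composite-not-third {t1} {t2} {t0} _ _ _ (_ , _ , ab) (_ , _ , be) (_ , _ , ae) = cycle₃ ab be ae
  composite-not-third {t1} {t2} {t3} _ _ _ (_ , _ , ab) (_ , _ , be) (_ , _ , ae) = cycle₃ ab be ae
  composite-not-third {t1} {t3} {t0} _ _ _ (_ , ab , _) (_ , be , _) (_ , ae , _) = cycle₂ ab be ae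
  composite-not-third {t1} {t3} {t2} _ _ _ (_ , ab , _) (_ , be , _) (_ , ae , _) = cycle₂ ab be ae
  composite-not-third {t2} {t0} {t1} _ _ _ (_ , ab , _) (_ , be , _) (_ , ae , _) = cycle₂ ae be ab
  composite-not-third {t2} {t0} {t3} _ _ _ (_ , ab , _) (_ , be , _) (_ , ae , _) = cycle₂ ae be ab
  composite-not-third {t2} {t1} {t0} _ _ _ (_ , _ , ab) (_ , _ , be) (_ , _ , ae) = cycle₃ ab be ae
  composite-not-third {t2} {t1} {t3} _ _ _ (_ , _ , ab) (_ , _ , be) (_ , _ , ae) = cycle₃ ab be ae
  composite-not-third {t2} {t3} {t0} _ _ _ (ab , _ , _) (be , _ , _) (ae , _ , _) = cycle₁ ab be ae
  composite-not-third {t2} {t3} {t1} _ _ _ (ab , _ , _) (be , _ , _) (ae , _ , _) = cycle₁ ab be ae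
  composite-not-third {t3} {t0} {t1} _ _ _ (_ , _ , ab) (_ , _ , be) (_ , _ , ae) = cycle₃ ae be ab
  composite-not-third {t3} {t0} {t2} _ _ _ (_ , _ , ab) (_ , _ , be) (_ , _ , ae) = cycle₃ ae be ab
  composite-not-third {t3} {t1} {t0} _ _ _ (_ , ab , _) (_ , be , _) (_ , ae , _) = cycle₂ ab be ae
  composite-not-third {t3} {t1} {t2} _ _ _ (_ , ab , _) (_ , be , _) (_ , ae , _) = cycle₂ ab be ae
  composite-not-third {t3} {t2} {t0} _ _ _ (ab , _ , _) (be , _ , _) (ae , _ , _) = cycle₁ ab be ae
  composite-not-third {t3} {t2} {t1} _ _ _ (ab , _ , _) (be , _ , _) (ae , _ , _) = cycle₁ ab be ae
  composite-not-third {t0} {t0} p≢q _ _ _ _ _ = contradiction refl p≢q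
  composite-not-third {t1} {t1} p≢q _ _ _ _ _ = contradiction refl p≢q
  composite-not-third {t2} {t2} p≢q _ _ _ _ _ = contradiction refl p≢q
  composite-not-third {t3} {t3} p≢q _ _ _ _ _ = contradiction refl p≢q
  composite-not-third {t0} {_} {t0} _ t≢p _ _ _ _ = contradiction refl t≢p
  composite-not-third {t1} {_} {t1} _ t≢p _ _ _ _ = contradiction refl t≢p
  composite-not-third {t2} {_} {t2} _ t≢p _ _ _ _ = contradiction refl t≢p
  composite-not-third {t3} {_} {t3} _ t≢p _ _ _ _ = contradiction refl t≢p
  composite-not-third {_} {t0} {t0} _ _ t≢q _ _ _ = contradiction refl t≢q
  composite-not-third {_} {t1} {t1} _ _ t≢q _ _ _ = contradiction refl t≢q
  composite-not-third {_} {t2} {t2} _ _ t≢q _ _ _ = contradiction refl t≢q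
  composite-not-third {_} {t3} {t3} _ _ t≢q _ _ _ = contradiction refl t≢q

  composite-type : ∀ {p q a b e} → p ≢ q → a —[ p ]→ b → b —[ q ]→ e →
    a —[ p ]→ e ⊎ a —[ q ]→ e ⊎ ∃[ t ] t ≢ p × t ≢ q × e —[ t ]→ a
  composite-type {p} {q} p≢q ab be with pair-type (λ { refl → type-asym ab be })
  ... | t , inj₂ ea = inj₂ (inj₂ (t , (λ { refl → no-C₃-uuv ea ab be }) , (λ { refl → no-C₃-uuv be ea ab }) , ea))
  ... | t , inj₁ ae with t ≟ p | t ≟ q
  ...   | yes refl | _ = inj₁ ae
  ...   | no _ | yes refl = inj₂ (inj₁ ae)
  ...   | no t≢p | no t≢q = contradiction ae (composite-not-third p≢q t≢p t≢q ab be)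

  module _ {σ : Carrier ↔ Carrier} (aut : IsAutomorphism Γ σ) where
    private
      f : Carrier → Carrier
      f = Inverse.to σ

    preserves₁ : ∀ {x y} → x <₁ y → f x <₁ f y
    preserves₁ {x} {y} = Equivalence.to (proj₁ (aut x y))
    preserves₂ : ∀ {x y} → x <₂ y → f x <₂ f y
    preserves₂ {x} {y} = Equivalence.to (proj₁ (proj₂ (aut x y)))
    preserves₃ : ∀ {x y} → x <₃ y → f x <₃ f y
    preserves₃ {x} {y} = Equivalence.to (proj₂ (proj₂ (aut x y)))

    automorphism-preserves-type : ∀ {t x y} → x —[ t ]→ y → f x —[ t ]→ f y
    automorphism-preserves-type {t0} (h₁ , h₂ , h₃) = preserves₁ h₁ , preserves₂ h₂ , preserves₃ h₃
    automorphism-preserves-type {t1} (h₁ , h₂ , h₃) = preserves₁ h₁ , preserves₂ h₂ , preserves₃ h₃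
    automorphism-preserves-type {t2} (h₁ , h₂ , h₃) = preserves₁ h₁ , preserves₂ h₂ , preserves₃ h₃
    automorphism-preserves-type {t3} (h₁ , h₂ , h₃) = preserves₁ h₁ , preserves₂ h₂ , preserves₃ h₃

  single-point-iso : ∀ c b → IsFinitePartialIso Γ {1} (λ _ → c) (λ _ → b)
  single-point-iso c b =
    one-point , one-point , λ _ _ → both-empty irrefl₁ , both-empty irrefl₂ , both-empty irrefl₃
    where
    one-point : {P : Set} (i j : Fin 1) → P → i ≡ j
    one-point zero zero _ = refl
    both-empty : {_<_ : Carrier → Carrier → Set} → (∀ {x y} → x ≡ y → ¬ x < y) → (c < c) ⇔ (b < b)
    both-empty irrefl = mk⇔ (λ h → ⊥-elim (irrefl refl h)) (λ h → ⊥-elim (irrefl refl h))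

  type-realized-everywhere : Homogeneous Γ → ∀ {t} → RealizedType Γ t → ∀ b → ∃[ e ] b —[ t ]→ e
  type-realized-everywhere (_ , extend) {t} (c , d , cd) b
    with σ , aut , c↦b ← extend 1 (λ _ → c) (λ _ → b) (single-point-iso c b) =
    Inverse.to σ d , subst (_—[ t ]→ Inverse.to σ d) (c↦b zero) (automorphism-preserves-type {σ = σ} aut cd)

  realizes-⇒ : ∀ {p q x y z} → z —[ p ]→ x → z —[ p ]→ y → x —[ q ]→ y → Realized⇒ Γ p q
  realizes-⇒ zx zy xy =
    _ , _ , _ , (type-irrefl xy , ≢-sym (type-irrefl zy) , ≢-sym (type-irrefl zx)) , zx , zy , xy

  realizes-⇐ : ∀ {p q x y z} → x —[ p ]→ z → y —[ p ]→ z → x —[ q ]→ y → Realized⇐ Γ p q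
  realizes-⇐ xz yz xy = _ , _ , _ , (type-irrefl xy , type-irrefl yz , type-irrefl xz) , xz , yz , xy

  realizes-C₃ : ∀ {p q r x y z} → z —[ p ]→ x → x —[ q ]→ y → y —[ r ]→ z → RealizedC₃ Γ p q r
  realizes-C₃ zx xy yz =
    _ , _ , _ , (type-irrefl xy , type-irrefl yz , ≢-sym (type-irrefl zx)) , zx , xy , yz

open PermStr3Properties

lemma3p10 : (Γ : PermStr3) → Homogeneous Γ →
    (p q r s : Type2) →
    p ≢ q → p ≢ r → p ≢ s → q ≢ r → q ≢ s → r ≢ s →
    ¬ Realized⇒ Γ p q → ¬ RealizedC₃ Γ p q r → ¬ RealizedC₃ Γ p q s →
    RealizedType Γ p → RealizedType Γ q →
    Realized⇐ Γ q p
lemma3p10 Γ hom p q r s p≢q p≢r p≢s q≢r q≢s r≢s ¬p⇒q ¬C₃pqr ¬C₃pqs (a , b , ab) q-realized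
  with e , be ← type-realized-everywhere Γ hom q-realized b
  with composite-type Γ p≢q ab be
... | inj₁ ae = contradiction (realizes-⇒ Γ ab ae be) ¬p⇒q
... | inj₂ (inj₁ ae) = realizes-⇐ Γ ae be ab
... | inj₂ (inj₂ (t , t≢p , t≢q , ea)) with other-pair p≢q p≢r p≢s q≢r q≢s r≢s t≢p t≢q
...   | inj₁ refl = contradiction (realizes-C₃ Γ ab be ea) ¬C₃pqr
...   | inj₂ refl = contradiction (realizes-C₃ Γ ab be ea) ¬C₃pqs
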